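{- Let $n,r\ge1$ and $d\ge0$ be integers. Assume $S\subset[n]^r$ is $d$-maximal in $[n]^r$ and that for every $a\in S$ and every coordinate $i\in[r]$ there is $b\in S$ with $a_i=b_i$ and $\mathrm{dist}(a,b)=d$. Then $S$ is also $d$-maximal as a subset of $[n+1]^r$.
   Context: $[n]=\{1,\dots,n\}$; $[n]^r$ is the set of words of length $r$ over $[n]$, regarded as a subset of $[n+1]^r$. $\mathrm{dist}(a,b)=|\{i:a_i\ne b_i\}|$ is the Hamming distance and $\mathrm{diam}(S)=\max_{a,b\in S}\mathrm{dist}(a,b)$. A set $S\subset X$ (where $X=[n]^r$ or $[n+1]^r$) is $d$-maximal in $X$ if $\mathrm{diam}(S)=d$ and no set $T$ with $S\subsetneq T\subset X$ has diameter $d$. -}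

module Defs where

open import Level using (0ℓ)
open import Data.Nat using (ℕ; zero; suc; _+_; _≤_)
open import Data.Fin using (Fin; inject₁)
open import Data.Fin.Properties using (_≟_)
open import Data.Vec using (Vec; []; _∷_; map)
open import Data.Product using (Σ; _×_; ∃; ∃-syntax; _,_)
open import Relation.Nullary using (yes; no)
open import Relation.Unary using (Pred; _∈_; _⊆_)
open import Relation.Binary.PropositionalEquality using (_≡_)

-- Words of length r over an n-letter alphabet; Fin n = {0,…,n-1} plays the role of [n].
Word : ℕ → ℕ → Set
Word n r = Vec (Fin n) r

dist : ∀ {n r} → Word n r → Word n r → ℕ
dist [] [] = 0
dist (x ∷ xs) (y ∷ ys) with x ≟ y
... | yes _ = dist xs ys
... | no  _ = suc (dist xs ys)

HasDiam : ∀ {n r} → Pred (Word n r) 0ℓ → ℕ → Set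
HasDiam S d =
  (∀ a b → a ∈ S → b ∈ S → dist a b ≤ d) ×
  (∃[ a ] ∃[ b ] (a ∈ S × b ∈ S × dist a b ≡ d))

DMaximal : ∀ {n r} → ℕ → Pred (Word n r) 0ℓ → Set₁
DMaximal {n} {r} d S = HasDiam S d × ((T : Pred (Word n r) 0ℓ) → S ⊆ T → HasDiam T d → T ⊆ S)

embed : ∀ {n r} → Word n r → Word (suc n) r
embed = map inject₁

Lift : ∀ {n r} → Pred (Word n r) 0ℓ → Pred (Word (suc n) r) 0ℓ
Lift S w = ∃[ v ] (v ∈ S × w ≡ embed v)

{-# OPTIONS --safe #-}
-- A word w of [n+1]^r lying in a set T ⊇ S of diameter d is projected to [n]^r by
-- replacing every occurrence of the new letter by an old one. The projection agrees with
-- each a ∈ S wherever w does, so it is within distance d of S and, by maximality, lies in S.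
-- If w used the new letter at some coordinate i, the hypothesis gives b ∈ S agreeing with the
-- projection at i and at distance d from it; then w disagrees with b at i as well, so
-- dist w b > d, a contradiction.
module Submission where

open import Defs
open import Level using (0ℓ)
open import Data.Nat using (ℕ; suc; _≥_; _≤_; _<_; z≤n; s≤s)
open import Data.Nat.Properties using (≤-trans; m≤n⇒m≤1+n; m<n⇒m<1+n; <⇒≱)
open import Data.Fin using (Fin; zero; suc; inject₁; fromℕ)
open import Data.Fin.Properties using (_≟_; inject₁-injective; fromℕ≢inject₁)
open import Data.Vec using ([]; _∷_; lookup; map)
open import Data.Vec.Properties using (lookup-map)
open import Data.Product using (_×_; ∃-syntax; _,_; proj₁)
open import Data.Sum using (_⊎_; inj₁; inj₂)
open import Function using (_∘_)
open import Function.Definitions using (Injective)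
open import Relation.Nullary using (yes; no; contradiction)
open import Relation.Unary using (Pred; _∈_; _⊆_)
open import Relation.Binary.PropositionalEquality
  using (_≡_; _≢_; refl; sym; trans; cong; cong₂; subst; module ≡-Reasoning)

dist-refl : ∀ {p r} (a : Word p r) → dist a a ≡ 0
dist-refl []      = refl
dist-refl (x ∷ a) with x ≟ x
... | yes _  = dist-refl a
... | no x≢x = contradiction refl x≢x

dist-sym : ∀ {p r} (a b : Word p r) → dist a b ≡ dist b a
dist-sym []      []      = refl
dist-sym (x ∷ a) (y ∷ b) with x ≟ y | y ≟ x
... | yes _   | yes _   = dist-sym a b
... | no _    | no _    = cong suc (dist-sym a b)
... | yes x≡y | no y≢x  = contradiction (sym x≡y) y≢x
... | no x≢y  | yes y≡x = contradiction (sym y≡x) x≢y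

dist-map : ∀ {p q r} {f : Fin p → Fin q} → Injective _≡_ _≡_ f →
           (a b : Word p r) → dist (map f a) (map f b) ≡ dist a b
dist-map f-inj []      []      = refl
dist-map {f = f} f-inj (x ∷ a) (y ∷ b) with f x ≟ f y | x ≟ y
... | yes _     | yes _   = dist-map f-inj a b
... | no _      | no _    = cong suc (dist-map f-inj a b)
... | yes fx≡fy | no x≢y  = contradiction (f-inj fx≡fy) x≢y
... | no fx≢fy  | yes x≡y = contradiction (cong f x≡y) fx≢fy

dist-embed : ∀ {p r} (a b : Word p r) → dist (embed a) (embed b) ≡ dist a b
dist-embed = dist-map inject₁-injective

AgreesWherever : ∀ {p q r} → Word p r → Word p r → Word q r → Word q r → Set
AgreesWherever xs ys us vs = ∀ i → lookup us i ≡ lookup vs i → lookup xs i ≡ lookup ys i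

dist-mono : ∀ {p q r} (xs ys : Word p r) (us vs : Word q r) →
            AgreesWherever xs ys us vs → dist xs ys ≤ dist us vs
dist-mono []       []       []       []       _     = z≤n
dist-mono (x ∷ xs) (y ∷ ys) (u ∷ us) (v ∷ vs) agree with x ≟ y | u ≟ v
... | yes _   | yes _   = dist-mono xs ys us vs (agree ∘ suc)
... | yes _   | no _    = m≤n⇒m≤1+n (dist-mono xs ys us vs (agree ∘ suc))
... | no _    | no _    = s≤s (dist-mono xs ys us vs (agree ∘ suc))
... | no x≢y  | yes u≡v = contradiction (agree zero u≡v) x≢y

dist-mono-strict : ∀ {p q r} (xs ys : Word p r) (us vs : Word q r) →
                   AgreesWherever xs ys us vs →
                   (i : Fin r) → lookup xs i ≡ lookup ys i → lookup us i ≢ lookup vs i →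
                   dist xs ys < dist us vs
dist-mono-strict (x ∷ xs) (y ∷ ys) (u ∷ us) (v ∷ vs) agree zero x≡y u≢v with x ≟ y | u ≟ v
... | yes _   | no _    = s≤s (dist-mono xs ys us vs (agree ∘ suc))
... | no x≢y  | _       = contradiction x≡y x≢y
... | _       | yes u≡v = contradiction u≡v u≢v
dist-mono-strict (x ∷ xs) (y ∷ ys) (u ∷ us) (v ∷ vs) agree (suc i) xᵢ≡yᵢ uᵢ≢vᵢ
  with x ≟ y | u ≟ v | dist-mono-strict xs ys us vs (agree ∘ suc) i xᵢ≡yᵢ uᵢ≢vᵢ
... | yes _   | yes _   | tail< = tail<
... | yes _   | no _    | tail< = m<n⇒m<1+n tail<
... | no _    | no _    | tail< = s≤s tail<
... | no x≢y  | yes u≡v | _     = contradiction (agree zero u≡v) x≢y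

-- The new letter fromℕ (suc m) is sent to zero; any letter of the smaller alphabet would do,
-- which is why the alphabet must be nonempty.
lower : ∀ {m} → Fin (suc (suc m)) → Fin (suc m)
lower          zero    = zero
lower {ℕ.zero} (suc _) = zero
lower {suc m}  (suc x) = suc (lower x)

lower-inject₁ : ∀ {m} (y : Fin (suc m)) → lower (inject₁ y) ≡ y
lower-inject₁         zero    = refl
lower-inject₁ {suc m} (suc y) = cong suc (lower-inject₁ y)

inject₁-lower⊎fromℕ : ∀ {m} (x : Fin (suc (suc m))) → inject₁ (lower x) ≡ x ⊎ x ≡ fromℕ (suc m)
inject₁-lower⊎fromℕ          zero       = inj₁ refl
inject₁-lower⊎fromℕ {ℕ.zero} (suc zero) = inj₂ refl
inject₁-lower⊎fromℕ {suc m}  (suc x)    with inject₁-lower⊎fromℕ x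
... | inj₁ e = inj₁ (cong suc e)
... | inj₂ e = inj₂ (cong suc e)

embed-lower⊎fromℕ : ∀ {m r} (w : Word (suc (suc m)) r) →
                    embed (map lower w) ≡ w ⊎ ∃[ i ] lookup w i ≡ fromℕ (suc m)
embed-lower⊎fromℕ []      = inj₁ refl
embed-lower⊎fromℕ (x ∷ w) with inject₁-lower⊎fromℕ x | embed-lower⊎fromℕ w
... | inj₂ x≡top | _                 = inj₂ (zero , x≡top)
... | inj₁ _     | inj₂ (i , wᵢ≡top) = inj₂ (suc i , wᵢ≡top)
... | inj₁ x≡    | inj₁ w≡           = inj₁ (cong₂ _∷_ x≡ w≡)

lower-agrees : ∀ {m r} (w : Word (suc (suc m)) r) (a : Word (suc m) r) →
               AgreesWherever (map lower w) a w (embed a)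
lower-agrees w a i wᵢ≡ = begin
  lookup (map lower w) i        ≡⟨ lookup-map i lower w ⟩
  lower (lookup w i)            ≡⟨ cong lower wᵢ≡ ⟩
  lower (lookup (embed a) i)    ≡⟨ cong lower (lookup-map i inject₁ a) ⟩
  lower (inject₁ (lookup a i))  ≡⟨ lower-inject₁ (lookup a i) ⟩
  lookup a i                    ∎
  where open ≡-Reasoning

dist-lower-≤ : ∀ {m r} (w : Word (suc (suc m)) r) (a : Word (suc m) r) →
               dist (map lower w) a ≤ dist w (embed a)
dist-lower-≤ w a = dist-mono (map lower w) a w (embed a) (lower-agrees w a)

dist-lower-< : ∀ {m r} (w : Word (suc (suc m)) r) (a : Word (suc m) r) (i : Fin r) →
               lookup (map lower w) i ≡ lookup a i → lookup w i ≡ fromℕ (suc m) →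
               dist (map lower w) a < dist w (embed a)
dist-lower-< w a i agreeᵢ wᵢ≡top =
  dist-mono-strict (map lower w) a w (embed a) (lower-agrees w a) i agreeᵢ
    (λ wᵢ≡aᵢ → fromℕ≢inject₁ (trans (sym wᵢ≡top) (trans wᵢ≡aᵢ (lookup-map i inject₁ a))))

Lift-HasDiam : ∀ {n r d} {S : Pred (Word n r) 0ℓ} → HasDiam S d → HasDiam (Lift S) d
Lift-HasDiam {d = d} {S} (diamS , a , b , a∈S , b∈S , dist≡d) =
  diam , embed a , embed b , (a , a∈S , refl) , (b , b∈S , refl) , trans (dist-embed a b) dist≡d
  where
  diam : ∀ x y → x ∈ Lift S → y ∈ Lift S → dist x y ≤ d
  diam _ _ (x , x∈S , refl) (y , y∈S , refl) =
    subst (_≤ d) (sym (dist-embed x y)) (diamS x y x∈S y∈S)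

DMaximal-absorbs : ∀ {n r d} {S : Pred (Word n r) 0ℓ} → DMaximal d S →
                   (v : Word n r) → (∀ a → a ∈ S → dist v a ≤ d) → v ∈ S
DMaximal-absorbs {d = d} {S} ((diamS , a , b , a∈S , b∈S , dist≡d) , maximal) v near =
  maximal (λ x → x ∈ S ⊎ x ≡ v) inj₁ (diam , a , b , inj₁ a∈S , inj₁ b∈S , dist≡d) (inj₂ refl)
  where
  diam : ∀ x y → x ∈ S ⊎ x ≡ v → y ∈ S ⊎ y ≡ v → dist x y ≤ d
  diam x y (inj₁ x∈S)  (inj₁ y∈S)  = diamS x y x∈S y∈S
  diam x _ (inj₁ x∈S)  (inj₂ refl) = subst (_≤ d) (dist-sym v x) (near x x∈S)
  diam _ y (inj₂ refl) (inj₁ y∈S)  = near y y∈S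
  diam _ _ (inj₂ refl) (inj₂ refl) = subst (_≤ d) (sym (dist-refl v)) z≤n

proposition7 : (n r d : ℕ) → n ≥ 1 → r ≥ 1 →
    (S : Pred (Word n r) 0ℓ) →
    DMaximal d S →
    (∀ a → a ∈ S → (i : Fin r) →
      ∃[ b ] (b ∈ S × lookup a i ≡ lookup b i × dist a b ≡ d)) →
    DMaximal d (Lift S)
proposition7 (suc m) r d _ _ S maxS apart = Lift-HasDiam (proj₁ maxS) , maximal
  where
  maximal : (T : Pred (Word (suc (suc m)) r) 0ℓ) → Lift S ⊆ T → HasDiam T d → T ⊆ Lift S
  maximal T S⊆T (diamT , _) {w} w∈T = lifted (embed-lower⊎fromℕ w)
    where
    close : ∀ a → a ∈ S → dist w (embed a) ≤ d
    close a a∈S = diamT w (embed a) w∈T (S⊆T (a , a∈S , refl))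
    lowered∈S : map lower w ∈ S
    lowered∈S = DMaximal-absorbs maxS (map lower w)
                  (λ a a∈S → ≤-trans (dist-lower-≤ w a) (close a a∈S))
    lifted : embed (map lower w) ≡ w ⊎ ∃[ i ] lookup w i ≡ fromℕ (suc m) → w ∈ Lift S
    lifted (inj₁ embed≡w) = map lower w , lowered∈S , sym embed≡w
    lifted (inj₂ (i , wᵢ≡top)) with apart (map lower w) lowered∈S i
    ... | b , b∈S , agreeᵢ , dist≡d =
      contradiction (close b b∈S)
        (<⇒≱ (subst (_< dist w (embed b)) dist≡d (dist-lower-< w b i agreeᵢ wᵢ≡top)))
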